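{- Let $G$ be a connected chordal graph. If $D$ is a minimal separating set of edges of $G$, then the subgraph formed by the edges of $D$ (together with their endpoints) is connected.
   Context: A chordal graph is a simple undirected graph in which every cycle with four or more vertices has a chord. A set $D$ of edges is separating if $G$ with the edges of $D$ removed is disconnected; it is minimal separating if no proper subset of $D$ is separating. -}

module Defs where

open import Data.Nat using (ℕ; zero; suc; _+_; _≤_)
open import Data.Fin using (Fin; toℕ)
open import Data.Bool using (Bool; true; false; _∧_; not)
open import Data.Product using (Σ; _×_; _,_; ∃)
open import Data.Sum using (_⊎_)
open import Relation.Nullary using (¬_)
open import Relation.Binary.PropositionalEquality using (_≡_; _≢_)
open import Function.Definitions using (Injective)

record Graph : Set where
  field
    n     : ℕ
    adj   : Fin n → Fin n → Bool
    sym   : ∀ u v → adj u v ≡ adj v u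
    irr   : ∀ u → adj u u ≡ false
open Graph public

EdgeSet : ℕ → Set
EdgeSet n = Fin n → Fin n → Bool

data Walk {n : ℕ} (E : EdgeSet n) : Fin n → Fin n → Set where
  here : ∀ {u} → Walk E u u
  step : ∀ {u v w} → E u v ≡ true → Walk E v w → Walk E u w

ConnectedOn : {n : ℕ} → EdgeSet n → Set
ConnectedOn {n} E = ∀ (u v : Fin n) → Walk E u v

Connected : Graph → Set
Connected G = ConnectedOn (adj G)

IsEdgeSetOf : (G : Graph) → EdgeSet (n G) → Set
IsEdgeSetOf G D = (∀ u v → D u v ≡ D v u) × (∀ u v → D u v ≡ true → adj G u v ≡ true)

remove : (G : Graph) → EdgeSet (n G) → EdgeSet (n G)
remove G D u v = adj G u v ∧ not (D u v)

Separating : (G : Graph) → EdgeSet (n G) → Set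
Separating G D = Σ (Fin (n G)) λ u → Σ (Fin (n G)) λ v → ¬ Walk (remove G D) u v

ProperSubset : {m : ℕ} → EdgeSet m → EdgeSet m → Set
ProperSubset {m} D' D =
  (∀ u v → D' u v ≡ true → D u v ≡ true) ×
  Σ (Fin m) λ u → Σ (Fin m) λ v → (D u v ≡ true) × (D' u v ≡ false)

MinimalSeparating : (G : Graph) → EdgeSet (n G) → Set
MinimalSeparating G D =
  IsEdgeSetOf G D × Separating G D ×
  (∀ (D' : EdgeSet (n G)) → IsEdgeSetOf G D' → ProperSubset D' D → ¬ Separating G D')

CycSucc : (k : ℕ) → Fin k → Fin k → Set
CycSucc k i j = (toℕ j ≡ suc (toℕ i)) ⊎ (suc (toℕ i) ≡ k × toℕ j ≡ 0)

Consecutive : (k : ℕ) → Fin k → Fin k → Set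
Consecutive k i j = CycSucc k i j ⊎ CycSucc k j i

IsCycle : (G : Graph) (k : ℕ) → (Fin k → Fin (n G)) → Set
IsCycle G k c = Injective _≡_ _≡_ c × (∀ i j → CycSucc k i j → adj G (c i) (c j) ≡ true)

HasChord : (G : Graph) (k : ℕ) → (Fin k → Fin (n G)) → Set
HasChord G k c = Σ (Fin k) λ i → Σ (Fin k) λ j → (adj G (c i) (c j) ≡ true) × ¬ Consecutive k i j

Chordal : Graph → Set
Chordal G = ∀ (k : ℕ) → 4 ≤ k → (c : Fin k → Fin (n G)) → IsCycle G k c → HasChord G k c

Incident : (G : Graph) → EdgeSet (n G) → Fin (n G) → Set
Incident G D u = Σ (Fin (n G)) λ v → D u v ≡ true

EdgeSubgraphConnected : (G : Graph) → EdgeSet (n G) → Set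
EdgeSubgraphConnected G D = ∀ u v → Incident G D u → Incident G D v → Walk D u v

-- Let S and T be the components of G − D containing two vertices that D separates. If an edge of
-- D had both ends on the same side of S, the edges of G leaving S would form a smaller separating
-- set; hence every edge of D joins S to T. For edges a₁b₁ and a₂b₂ of D with aᵢ ∈ S and bᵢ ∈ T, a
-- path a₁ ⋯ a₂ in S, the edge a₂b₂, a path b₂ ⋯ b₁ in T and the edge b₁a₁ form a cycle, and every
-- edge of G between its S-part and its T-part lies in D. Induct on the length of such cycles:
-- while both parts have an edge, chordality yields a chord, which either shortcuts one part or,
-- running from S to T, splits the cycle into two shorter cycles of the same shape; once a part is a
-- single vertex, a₁ and a₂ are joined by at most two edges of D.

module Submission where

open import Data.Nat using (ℕ; zero; suc; _+_; _∸_; _≤_; _<_; z≤n; s≤s; z<s)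
open import Data.Nat.Properties
open import Data.Fin using (Fin; toℕ; fromℕ<) renaming (_≟_ to _≟ᶠ_)
open import Data.Fin.Properties using (toℕ-injective; toℕ<n; toℕ-fromℕ<; any?; injective⇒≤)
open import Data.Bool using (Bool; true; false; _∧_; not; _xor_)
open import Data.Bool.Properties using (∧-conicalˡ; ∧-zeroʳ; xor-comm; xor-same; ¬-not) renaming (_≟_ to _≟ᵇ_)
open import Data.Product using (_×_; _,_; ∃; proj₁; proj₂)
open import Data.Sum using (_⊎_; inj₁; inj₂)
open import Data.Unit using (⊤; tt)
open import Data.Empty using (⊥; ⊥-elim)
open import Relation.Nullary using (¬_; Dec; yes; no; does)
open import Relation.Nullary.Decidable using (_×-dec_; _⊎-dec_; dec-true; dec-false)
open import Relation.Binary.PropositionalEquality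
open import Relation.Binary.Definitions using (tri<; tri≈; tri>)
open import Defs hiding (sym)

private
  true≢false : true ≢ false
  true≢false ()

module _ {m : ℕ} {R : EdgeSet m} where

  infixr 5 _++ʷ_
  _++ʷ_ : ∀ {u v w} → Walk R u v → Walk R v w → Walk R u w
  here       ++ʷ q = q
  step e p   ++ʷ q = step e (p ++ʷ q)

  reverseʷ : (∀ u v → R u v ≡ R v u) → ∀ {u v} → Walk R u v → Walk R v u
  reverseʷ Rsym here = here
  reverseʷ Rsym (step {u} {v} e p) = reverseʷ Rsym p ++ʷ step (trans (Rsym v u) e) here

  walk-invariant : {A : Set} (h : Fin m → A) → (∀ u v → R u v ≡ true → h u ≡ h v) →
                   ∀ {u v} → Walk R u v → h u ≡ h v
  walk-invariant h inv here = refl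
  walk-invariant h inv (step e p) = trans (inv _ _ e) (walk-invariant h inv p)

Chain : {m : ℕ} → EdgeSet m → ℕ → (ℕ → Fin m) → Set
Chain R len P = ∀ t → t < len → R (P t) (P (suc t)) ≡ true

InjectiveUpTo : {A : Set} → ℕ → (ℕ → A) → Set
InjectiveUpTo len P = ∀ x y → x ≤ len → y ≤ len → P x ≡ P y → x ≡ y

record IsPath {m : ℕ} (R : EdgeSet m) (I : Fin m → Set) (len : ℕ) (P : ℕ → Fin m) : Set where
  field
    chain     : Chain R len P
    injective : InjectiveUpTo len P
    inside    : ∀ t → t ≤ len → I (P t)
open IsPath public

record Path {m : ℕ} (R : EdgeSet m) (I : Fin m → Set) (u v : Fin m) : Set where
  field
    len    : ℕ
    vertex : ℕ → Fin m
    isPath : IsPath R I len vertex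
    start  : vertex 0 ≡ u
    end    : vertex len ≡ v
open Path public

IsPath-map : ∀ {m} {R R' : EdgeSet m} {I I' : Fin m → Set} {len P} →
             (∀ u v → R u v ≡ true → R' u v ≡ true) → (∀ v → I v → I' v) →
             IsPath R I len P → IsPath R' I' len P
IsPath-map R⊆R' I⊆I' π = record
  { chain     = λ t t< → R⊆R' _ _ (chain π t t<)
  ; injective = injective π
  ; inside    = λ t t≤ → I⊆I' _ (inside π t t≤) }

join : {A : Set} → ℕ → (ℕ → A) → (ℕ → A) → ℕ → A
join p P Q t with t ≤? p
... | yes _ = P t
... | no _  = Q (t ∸ suc p)

module _ {A : Set} (p : ℕ) (P Q : ℕ → A) where

  join-left : ∀ {t} → t ≤ p → join p P Q t ≡ P t
  join-left {t} t≤p with t ≤? p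
  ... | yes _  = refl
  ... | no t≰p = ⊥-elim (t≰p t≤p)

  join-right : ∀ s → join p P Q (suc p + s) ≡ Q s
  join-right s with suc p + s ≤? p
  ... | yes le = ⊥-elim (<⇒≱ (m≤m+n (suc p) s) le)
  ... | no _   = cong Q (m+n∸m≡n (suc p) s)

data Segment (p : ℕ) : ℕ → Set where
  left  : ∀ {t} → t ≤ p → Segment p t
  right : ∀ s → Segment p (suc p + s)

segment : ∀ p t → Segment p t
segment p t with t ≤? p
... | yes t≤p = left t≤p
... | no t≰p  = subst (Segment p) (m+[n∸m]≡n (≰⇒> t≰p)) (right (t ∸ suc p))

right-bound : ∀ {p q s t} → t ≡ suc p + s → t ≤ suc p + q → s ≤ q
right-bound {p} refl = +-cancelˡ-≤ (suc p) _ _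

shortcut : {A : Set} → (ℕ → A) → ℕ → ℕ → ℕ → A
shortcut P x y = join x P (λ t → P (y + t))

module _ {A : Set} (P : ℕ → A) where

  shortcut-start : ∀ x y → shortcut P x y 0 ≡ P 0
  shortcut-start x y = join-left x P (λ t → P (y + t)) z≤n

  shortcut-end : ∀ x {y len} → y ≤ len → shortcut P x y (suc x + (len ∸ y)) ≡ P len
  shortcut-end x {y} {len} y≤ = trans (join-right x P (λ t → P (y + t)) (len ∸ y)) (cong P (m+[n∸m]≡n y≤))

  shortcut-shorter : ∀ {x y len} → x < y → y ≢ suc x → y ≤ len → suc x + (len ∸ y) < len
  shortcut-shorter {x} {y} {len} x<y y≢ y≤ = subst (suc x + (len ∸ y) <_) (m+[n∸m]≡n y≤)
    (+-monoˡ-< (len ∸ y) (≤∧≢⇒< x<y (λ e → y≢ (sym e))))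

module _ {m : ℕ} {R : EdgeSet m} {I : Fin m → Set} where

  join-isPath : ∀ {p q P Q} → IsPath R I p P → IsPath R I q Q → R (P p) (Q 0) ≡ true →
                (∀ x s → x ≤ p → s ≤ q → P x ≢ Q s) → IsPath R I (suc p + q) (join p P Q)
  join-isPath {p} {q} {P} {Q} πP πQ bridge disjoint = record
    { chain = joinChain ; injective = joinInjective ; inside = joinInside }
    where
      PQ : ℕ → Fin m
      PQ = join p P Q

      PQ-left : ∀ {t} → t ≤ p → PQ t ≡ P t
      PQ-left = join-left p P Q

      PQ-right : ∀ s → PQ (suc p + s) ≡ Q s
      PQ-right = join-right p P Q

      joinChain : Chain R (suc p + q) PQ
      joinChain t t< with segment p t
      ... | right s = subst₂ (λ a b → R a b ≡ true) (sym (PQ-right s))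
                        (sym (trans (cong PQ (sym (+-suc (suc p) s))) (PQ-right (suc s))))
                        (chain πQ s (+-cancelˡ-< (suc p) s q t<))
      ... | left t≤p with m≤n⇒m<n∨m≡n t≤p
      ...   | inj₁ t<p = subst₂ (λ a b → R a b ≡ true) (sym (PQ-left t≤p)) (sym (PQ-left t<p)) (chain πP t t<p)
      ...   | inj₂ refl = subst₂ (λ a b → R a b ≡ true) (sym (PQ-left t≤p))
                            (sym (trans (cong PQ (sym (+-identityʳ (suc p)))) (PQ-right 0))) bridge

      joinInside : ∀ t → t ≤ suc p + q → I (PQ t)
      joinInside t t≤ with segment p t
      ... | left t≤p = subst I (sym (PQ-left t≤p)) (inside πP t t≤p)
      ... | right s  = subst I (sym (PQ-right s)) (inside πQ s (right-bound refl t≤))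

      joinInjective : InjectiveUpTo (suc p + q) PQ
      joinInjective x y x≤ y≤ e with segment p x | segment p y
      ... | left x≤p | left y≤p =
        injective πP x y x≤p y≤p (trans (sym (PQ-left x≤p)) (trans e (PQ-left y≤p)))
      ... | right s | right s' =
        cong (suc p +_) (injective πQ s s' (right-bound refl x≤) (right-bound refl y≤)
                          (trans (sym (PQ-right s)) (trans e (PQ-right s'))))
      ... | left x≤p | right s =
        ⊥-elim (disjoint x s x≤p (right-bound refl y≤) (trans (sym (PQ-left x≤p)) (trans e (PQ-right s))))
      ... | right s | left y≤p =
        ⊥-elim (disjoint y s y≤p (right-bound refl x≤) (trans (sym (PQ-left y≤p)) (trans (sym e) (PQ-right s))))

  take-isPath : ∀ {len P x} → IsPath R I len P → x ≤ len → IsPath R I x P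
  take-isPath π x≤ = record
    { chain     = λ t t< → chain π t (<-≤-trans t< x≤)
    ; injective = λ a b a≤ b≤ → injective π a b (≤-trans a≤ x≤) (≤-trans b≤ x≤)
    ; inside    = λ t t≤ → inside π t (≤-trans t≤ x≤) }

  drop-isPath : ∀ {len P x} → IsPath R I len P → x ≤ len → IsPath R I (len ∸ x) (λ t → P (x + t))
  drop-isPath {len} {P} {x} π x≤ = record
    { chain     = λ t t< → subst (λ z → R (P (x + t)) (P z) ≡ true) (sym (+-suc x t))
                                 (chain π (x + t) (subst (_≤ len) (+-suc x t) (shifted t< )))
    ; injective = λ a b a≤ b≤ e → +-cancelˡ-≡ x a b (injective π (x + a) (x + b) (shifted a≤) (shifted b≤) e)
    ; inside    = λ t t≤ → inside π (x + t) (shifted t≤) }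
    where
      shifted : ∀ {t} → t ≤ len ∸ x → x + t ≤ len
      shifted {t} t≤ = subst (x + t ≤_) (m+[n∸m]≡n x≤) (+-monoʳ-≤ x t≤)

  shortcut-isPath : ∀ {len P x y} → IsPath R I len P → x < y → y ≤ len → R (P x) (P y) ≡ true →
                    IsPath R I (suc x + (len ∸ y)) (shortcut P x y)
  shortcut-isPath {len} {P} {x} {y} π x<y y≤ e =
    join-isPath (take-isPath π (<⇒≤ (<-≤-trans x<y y≤))) (drop-isPath π y≤)
      (subst (λ z → R (P x) (P z) ≡ true) (sym (+-identityʳ y)) e) disjoint
    where
      disjoint : ∀ a s → a ≤ x → s ≤ len ∸ y → P a ≢ P (y + s)
      disjoint a s a≤ s≤ e' = <⇒≢ (<-≤-trans (≤-<-trans a≤ x<y) (m≤m+n y s))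
        (injective π a (y + s) (≤-trans a≤ (<⇒≤ (<-≤-trans x<y y≤)))
          (subst (y + s ≤_) (m+[n∸m]≡n y≤) (+-monoʳ-≤ y s≤)) e')

  trivial-isPath : ∀ {u} → I u → IsPath R I 0 (λ _ → u)
  trivial-isPath Iu = record
    { chain = λ _ () ; injective = λ { _ _ z≤n z≤n _ → refl } ; inside = λ _ _ → Iu }

  walk⇒path : (∀ x y → R x y ≡ true → I x → I y) → ∀ {u v} → I u → Walk R u v → Path R I u v
  walk⇒path closed {u} Iu here = record
    { len = 0 ; vertex = λ _ → u ; isPath = trivial-isPath Iu ; start = refl ; end = refl }
  walk⇒path closed {u} Iu (step e w) with walk⇒path closed (closed _ _ e Iu) w
  ... | π with any? (λ (i : Fin (suc (len π))) → vertex π (toℕ i) ≟ᶠ u)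
  ...   | yes (i , revisit) = record
    { len    = len π ∸ toℕ i
    ; vertex = λ t → vertex π (toℕ i + t)
    ; isPath = drop-isPath (isPath π) (≤-pred (toℕ<n i))
    ; start  = trans (cong (vertex π) (+-identityʳ (toℕ i))) revisit
    ; end    = trans (cong (vertex π) (m+[n∸m]≡n (≤-pred (toℕ<n i)))) (end π) }
  ...   | no fresh = record
    { len    = suc (len π)
    ; vertex = join 0 (λ _ → u) (vertex π)
    ; isPath = join-isPath (trivial-isPath Iu) (isPath π)
                 (subst (λ z → R u z ≡ true) (sym (start π)) e) unvisited
    ; start  = join-left 0 (λ _ → u) (vertex π) z≤n
    ; end    = trans (join-right 0 (λ _ → u) (vertex π) (len π)) (end π) }
    where
      unvisited : ∀ x s → x ≤ 0 → s ≤ len π → u ≢ vertex π s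
      unvisited _ s _ s≤ u≡ = fresh (fromℕ< (s≤s s≤) , trans (cong (vertex π) (toℕ-fromℕ< (s≤s s≤))) (sym u≡))

  isPath⇒len< : ∀ {len P} → IsPath R I len P → len < m
  isPath⇒len< {len} {P} π = injective⇒≤ {f = λ (i : Fin (suc len)) → P (toℕ i)}
    (λ {i} {j} e → toℕ-injective (injective π _ _ (≤-pred (toℕ<n i)) (≤-pred (toℕ<n j)) e))

Reach : {m : ℕ} → EdgeSet m → ℕ → Fin m → Fin m → Set
Reach R zero    u v = u ≡ v
Reach R (suc k) u v = u ≡ v ⊎ ∃ λ w → R u w ≡ true × Reach R k w v

module _ {m : ℕ} {R : EdgeSet m} where

  reach? : ∀ k u v → Dec (Reach R k u v)
  reach? zero    u v = u ≟ᶠ v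
  reach? (suc k) u v = (u ≟ᶠ v) ⊎-dec any? (λ w → (R u w ≟ᵇ true) ×-dec reach? k w v)

  reach⇒walk : ∀ k {u v} → Reach R k u v → Walk R u v
  reach⇒walk zero    refl                = here
  reach⇒walk (suc k) (inj₁ refl)         = here
  reach⇒walk (suc k) (inj₂ (w , e , r)) = step e (reach⇒walk k r)

  reach-mono : ∀ {k k' u v} → k ≤ k' → Reach R k u v → Reach R k' u v
  reach-mono {zero}  {zero}   _        r                  = r
  reach-mono {zero}  {suc k'} _        r                  = inj₁ r
  reach-mono {suc k} {suc k'} _        (inj₁ r)           = inj₁ r
  reach-mono {suc k} {suc k'} (s≤s le) (inj₂ (w , e , r)) = inj₂ (w , e , reach-mono le r)

  chain⇒reach : ∀ len (P : ℕ → Fin m) → Chain R len P → Reach R len (P 0) (P len)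
  chain⇒reach zero    P _ = refl
  chain⇒reach (suc len) P c =
    inj₂ (P 1 , c 0 z<s , chain⇒reach len (λ t → P (suc t)) (λ t t< → c (suc t) (s≤s t<)))

  walk⇒reach : ∀ {u v} → Walk R u v → Reach R m u v
  walk⇒reach w with walk⇒path {I = λ _ → ⊤} (λ _ _ _ _ → tt) tt w
  ... | record { len = len ; vertex = P ; isPath = π ; start = refl ; end = refl } =
    reach-mono (<⇒≤ (isPath⇒len< π)) (chain⇒reach len P (chain π))

  walk? : ∀ u v → Dec (Walk R u v)
  walk? u v with reach? m u v
  ... | yes r = yes (reach⇒walk m r)
  ... | no ¬r = no (λ w → ¬r (walk⇒reach w))

module _ {m : ℕ} (R : EdgeSet m) where

  reachable : Fin m → Fin m → Bool
  reachable r v = does (walk? {R = R} r v)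

  reachable-sound : ∀ {r v} → reachable r v ≡ true → Walk R r v
  reachable-sound {r} {v} with walk? {R = R} r v
  ... | yes w = λ _ → w
  ... | no _  = λ ()

  reachable-complete : ∀ {r v} → Walk R r v → reachable r v ≡ true
  reachable-complete {r} {v} = dec-true (walk? r v)

  reachable-invariant : (∀ u v → R u v ≡ R v u) →
                        ∀ r u v → R u v ≡ true → reachable r u ≡ reachable r v
  reachable-invariant Rsym r u v e with walk? {R = R} r u
  ... | yes w  = sym (dec-true (walk? r v) (w ++ʷ step e here))
  ... | no ¬w = sym (dec-false (walk? r v) (λ w → ¬w (w ++ʷ step (trans (Rsym v u) e) here)))

module _ (G : Graph) where

  cut : (Fin (n G) → Bool) → EdgeSet (n G)
  cut h u v = adj G u v ∧ (h u xor h v)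

  cut-isEdgeSet : ∀ h → IsEdgeSetOf G (cut h)
  cut-isEdgeSet h =
    (λ u v → cong₂ _∧_ (Graph.sym G u v) (xor-comm (h u) (h v))) , (λ u v → ∧-conicalˡ _ _)

  cut-uncut : ∀ h {u v} → h u ≡ h v → cut h u v ≡ false
  cut-uncut h {u} {v} hu≡hv =
    trans (cong (λ b → adj G u v ∧ (b xor h v)) hu≡hv) (trans (cong (adj G u v ∧_) (xor-same (h v))) (∧-zeroʳ _))

  cut-separates : ∀ h {r r'} → h r ≢ h r' → Separating G (cut h)
  cut-separates h {r} {r'} hr≢hr' = r , r' , λ w → hr≢hr' (walk-invariant h uncut w)
    where
      agree : ∀ a b c → a ∧ not (a ∧ (b xor c)) ≡ true → b ≡ c
      agree true false false _ = refl
      agree true true  true  _ = refl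

      uncut : ∀ u v → remove G (cut h) u v ≡ true → h u ≡ h v
      uncut u v = agree (adj G u v) (h u) (h v)

  cut⊆ : ∀ {D} h → (∀ u v → remove G D u v ≡ true → h u ≡ h v) →
         ∀ u v → cut h u v ≡ true → D u v ≡ true
  cut⊆ {D} h inv u v e with D u v in Duv
  ... | true  = refl
  ... | false = trans (sym (cut-uncut h (inv u v (cong₂ (λ a d → a ∧ not d) (∧-conicalˡ _ _ e) Duv)))) e

  minimal-separating-crosses : ∀ {D} → MinimalSeparating G D → ∀ h →
    (∀ u v → remove G D u v ≡ true → h u ≡ h v) → ∀ {r r'} → h r ≢ h r' →
    ∀ x y → D x y ≡ true → h x ≢ h y
  minimal-separating-crosses (_ , _ , minimal) h inv hr≢hr' x y Dxy hx≡hy =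
    minimal (cut h) (cut-isEdgeSet h) (cut⊆ h inv , x , y , Dxy , cut-uncut h hx≡hy) (cut-separates h hr≢hr')

record Chord {m : ℕ} (R : EdgeSet m) (len : ℕ) (P : ℕ → Fin m) : Set where
  field
    i j         : ℕ
    i<j         : i < j
    j≤len       : j ≤ len
    edge        : R (P i) (P j) ≡ true
    skips       : j ≢ suc i
    not-closing : ¬ (i ≡ 0 × j ≡ len)

module _ (G : Graph) {len : ℕ} {P : ℕ → Fin (n G)} where

  closed-path⇒cycle : ∀ {I} → IsPath (adj G) I len P → adj G (P len) (P 0) ≡ true →
                      IsCycle G (suc len) (λ i → P (toℕ i))
  closed-path⇒cycle π closing =
    (λ {i} {j} e → toℕ-injective (injective π _ _ (≤-pred (toℕ<n i)) (≤-pred (toℕ<n j)) e)) , adjacent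
    where
      adjacent : ∀ i j → CycSucc (suc len) i j → adj G (P (toℕ i)) (P (toℕ j)) ≡ true
      adjacent i j (inj₁ j≡) = subst (λ t → adj G (P (toℕ i)) (P t) ≡ true) (sym j≡)
        (chain π (toℕ i) (≤-pred (subst (_< suc len) j≡ (toℕ<n j))))
      adjacent i j (inj₂ (i≡ , j≡0)) = subst₂ (λ u v → adj G u v ≡ true)
        (cong P (sym (suc-injective i≡))) (cong P (sym j≡0)) closing

  cycle-chord : HasChord G (suc len) (λ i → P (toℕ i)) → Chord (adj G) len P
  cycle-chord (i , j , e , nonconsecutive) with <-cmp (toℕ i) (toℕ j)
  ... | tri< i<j _ _ = record
    { i = toℕ i ; j = toℕ j ; i<j = i<j ; j≤len = ≤-pred (toℕ<n j) ; edge = e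
    ; skips       = λ j≡ → nonconsecutive (inj₁ (inj₁ j≡))
    ; not-closing = λ (i≡0 , j≡len) → nonconsecutive (inj₂ (inj₂ (cong suc j≡len , i≡0))) }
  ... | tri≈ _ i≡j _ = ⊥-elim (true≢false (trans (sym loop) (irr G _)))
    where
      loop : adj G (P (toℕ i)) (P (toℕ i)) ≡ true
      loop = subst (λ t → adj G (P (toℕ i)) (P t) ≡ true) (sym i≡j) e
  ... | tri> _ _ j<i = record
    { i = toℕ j ; j = toℕ i ; i<j = j<i ; j≤len = ≤-pred (toℕ<n i) ; edge = trans (Graph.sym G _ _) e
    ; skips       = λ i≡ → nonconsecutive (inj₂ (inj₁ i≡))
    ; not-closing = λ (j≡0 , i≡len) → nonconsecutive (inj₁ (inj₂ (cong suc i≡len , j≡0))) }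

m+[n∸o]<p+n : ∀ {m n o p} → m ≤ p → o ≤ n → ¬ (m ≡ p × o ≡ 0) → m + (n ∸ o) < p + n
m+[n∸o]<p+n {m} {n} {o} m≤p o≤n not-both with m≤n⇒m<n∨m≡n m≤p
... | inj₁ m<p = +-mono-<-≤ m<p (m∸n≤m n o)
m+[n∸o]<p+n {o = zero}      _ _   not-both | inj₂ refl = ⊥-elim (not-both (refl , refl))
m+[n∸o]<p+n {m} {o = suc _} _ o≤n _        | inj₂ refl = +-monoʳ-< m (∸-monoʳ-< z<s o≤n)

module _ (G : Graph) (chordal : Chordal G)
         (D : EdgeSet (n G)) (Dsym : ∀ x y → D x y ≡ D y x)
         (σ : Fin (n G) → Bool) (boundary⊆D : ∀ x y → adj G x y ≡ true → σ x ≢ σ y → D x y ≡ true) where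

  private
    Edge : Fin (n G) → Fin (n G) → Set
    Edge u v = adj G u v ≡ true

  OnSide : Bool → Fin (n G) → Set
  OnSide b v = σ v ≡ b

  SidedCycleWalk : ℕ → Set
  SidedCycleWalk bound = ∀ {p q P Q} → p + q < bound →
    IsPath (adj G) (OnSide true) p P → IsPath (adj G) (OnSide false) q Q →
    Edge (P p) (Q 0) → Edge (Q q) (P 0) → Walk D (P 0) (P p)

  crossing-edge : ∀ {x y} → σ x ≡ true → σ y ≡ false → Edge x y → D x y ≡ true
  crossing-edge σx σy e = boundary⊆D _ _ e (λ σx≡σy → true≢false (trans (sym σx) (trans σx≡σy σy)))

  module _ {p q P Q} (ih : SidedCycleWalk (p + q))
           (πP : IsPath (adj G) (OnSide true) p P) (πQ : IsPath (adj G) (OnSide false) q Q)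
           (bridge : Edge (P p) (Q 0)) (closing : Edge (Q q) (P 0)) where

    crossing-chord-walk : ∀ {x s} → x ≤ p → s ≤ q → Edge (P x) (Q s) →
                          ¬ (x ≡ p × s ≡ 0) → ¬ (x ≡ 0 × s ≡ q) → Walk D (P 0) (P p)
    crossing-chord-walk {x} {s} x≤p s≤q e not-bridge not-closing = walk-to-x ++ʷ walk-from-x
      where
        walk-to-x : Walk D (P 0) (P x)
        walk-to-x = ih (m+[n∸o]<p+n x≤p s≤q not-bridge)
          (take-isPath πP x≤p) (drop-isPath πQ s≤q)
          (subst (λ t → Edge (P x) (Q t)) (sym (+-identityʳ s)) e)
          (subst (λ t → Edge (Q t) (P 0)) (sym (m+[n∸m]≡n s≤q)) closing)

        walk-from-x : Walk D (P x) (P p)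
        walk-from-x = subst₂ (Walk D) (cong P (+-identityʳ x)) (cong P (m+[n∸m]≡n x≤p))
          (ih (subst₂ _<_ (+-comm s (p ∸ x)) (+-comm q p)
                 (m+[n∸o]<p+n s≤q x≤p (λ (s≡q , x≡0) → not-closing (x≡0 , s≡q))))
            (drop-isPath πP x≤p) (take-isPath πQ s≤q)
            (subst (λ t → Edge (P t) (Q 0)) (sym (m+[n∸m]≡n x≤p)) bridge)
            (subst (λ t → Edge (Q s) (P t)) (sym (+-identityʳ x)) (trans (Graph.sym G _ _) e)))

    private
      PQ : ℕ → Fin (n G)
      PQ = join p P Q

    chord-walk : Chord (adj G) (suc p + q) PQ → Walk D (P 0) (P p)
    chord-walk record { i = i ; j = j ; i<j = i<j ; j≤len = j≤ ; edge = e
                      ; skips = skips ; not-closing = not-closing } =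
      by-segments (segment p i) (segment p j) i<j j≤ e skips not-closing
      where
        by-segments : ∀ {i j} → Segment p i → Segment p j → i < j → j ≤ suc p + q → Edge (PQ i) (PQ j) →
                      j ≢ suc i → ¬ (i ≡ 0 × j ≡ suc p + q) → Walk D (P 0) (P p)
        by-segments {i} {j} (left i≤p) (left j≤p) i<j _ e skips _ =
          subst₂ (Walk D) (shortcut-start P i j) (shortcut-end P i j≤p)
            (ih (+-monoˡ-< q (shortcut-shorter P i<j skips j≤p))
              (shortcut-isPath πP i<j j≤p (subst₂ Edge (join-left p P Q i≤p) (join-left p P Q j≤p) e))
              πQ
              (subst (λ v → Edge v (Q 0)) (sym (shortcut-end P i j≤p)) bridge)
              (subst (Edge (Q q)) (sym (shortcut-start P i j)) closing))
        by-segments (right s) (right s') s<s' j≤ e skips _ =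
          ih (+-monoʳ-< p (shortcut-shorter Q (+-cancelˡ-< (suc p) s s' s<s') skips' s'≤q))
            πP
            (shortcut-isPath πQ (+-cancelˡ-< (suc p) s s' s<s') s'≤q
              (subst₂ Edge (join-right p P Q s) (join-right p P Q s') e))
            (subst (Edge (P p)) (sym (shortcut-start Q s s')) bridge)
            (subst (λ v → Edge v (P 0)) (sym (shortcut-end Q s s'≤q)) closing)
          where
            s'≤q = right-bound refl j≤
            skips' : s' ≢ suc s
            skips' s'≡ = skips (trans (cong (suc p +_) s'≡) (+-suc (suc p) s))
        by-segments (left i≤p) (right s) _ j≤ e skips not-closing =
          crossing-chord-walk i≤p (right-bound refl j≤)
            (subst₂ Edge (join-left p P Q i≤p) (join-right p P Q s) e)
            (λ (i≡p , s≡0) → skips (trans (cong (suc p +_) s≡0) (trans (+-identityʳ (suc p)) (cong suc (sym i≡p)))))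
            (λ (i≡0 , s≡q) → not-closing (i≡0 , cong (suc p +_) s≡q))
        by-segments (right s) (left j≤p) i<j _ _ _ _ =
          ⊥-elim (1+n≰n (≤-trans (m≤m+n (suc p) s) (<⇒≤ (<-≤-trans i<j j≤p))))

  sided-cycle-walk : ∀ bound → SidedCycleWalk bound
  sided-cycle-walk zero ()
  sided-cycle-walk (suc bound) {zero} _ _ _ _ _ = here
  sided-cycle-walk (suc bound) {suc p} {zero} _ πP πQ bridge closing =
    step (crossing-edge (inside πP 0 z≤n) (inside πQ 0 z≤n) (trans (Graph.sym G _ _) closing))
      (step (trans (Dsym _ _) (crossing-edge (inside πP (suc p) ≤-refl) (inside πQ 0 z≤n) bridge)) here)
  sided-cycle-walk (suc bound) {suc p} {suc q} {P} {Q} size πP πQ bridge closing =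
    chord-walk (λ lt → sided-cycle-walk bound (<-≤-trans lt (≤-pred size))) πP πQ bridge closing
      (cycle-chord G (chordal _ 4≤length _ (closed-path⇒cycle G cycle-path cycle-closing)))
    where
      4≤length : 4 ≤ suc (suc (suc p) + suc q)
      4≤length = s≤s (s≤s (s≤s (≤-trans (s≤s z≤n) (m≤n+m (suc q) p))))

      cycle-path : IsPath (adj G) (λ _ → ⊤) (suc (suc p) + suc q) (join (suc p) P Q)
      cycle-path = join-isPath (IsPath-map (λ _ _ e → e) _ πP) (IsPath-map (λ _ _ e → e) _ πQ) bridge
        (λ x s x≤ s≤ Px≡Qs → true≢false (trans (sym (inside πP x x≤)) (trans (cong σ Px≡Qs) (inside πQ s s≤))))

      cycle-closing : Edge (join (suc p) P Q (suc (suc p) + suc q)) (join (suc p) P Q 0)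
      cycle-closing = subst₂ Edge (sym (join-right (suc p) P Q (suc q))) (sym (join-left (suc p) P Q z≤n)) closing

module _ (G : Graph) (D : EdgeSet (n G)) (minimal : MinimalSeparating G D) where

  private
    V = Fin (n G)

    G-D : EdgeSet (n G)
    G-D = remove G D

    Dsym : ∀ u v → D u v ≡ D v u
    Dsym = proj₁ (proj₁ minimal)

    D⊆G : ∀ u v → D u v ≡ true → adj G u v ≡ true
    D⊆G = proj₂ (proj₁ minimal)

    G-D-sym : ∀ u v → G-D u v ≡ G-D v u
    G-D-sym u v = cong₂ (λ a d → a ∧ not d) (Graph.sym G u v) (Dsym u v)

    s₀ t₀ : V
    s₀ = proj₁ (proj₁ (proj₂ minimal))
    t₀ = proj₁ (proj₂ (proj₁ (proj₂ minimal)))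

    s₀↛t₀ : ¬ Walk G-D s₀ t₀
    s₀↛t₀ = proj₂ (proj₂ (proj₁ (proj₂ minimal)))

    opposite : ∀ {x y} b → x ≡ b → x ≢ y → y ≡ not b
    opposite b x≡b x≢y = trans (¬-not (λ y≡x → x≢y (sym y≡x))) (cong not x≡b)

  component : V → V → Bool
  component = reachable G-D

  component-invariant : ∀ r u v → G-D u v ≡ true → component r u ≡ component r v
  component-invariant = reachable-invariant G-D G-D-sym

  D-crosses-component : ∀ {r r'} → ¬ Walk G-D r r' → ∀ x y → D x y ≡ true → component r x ≢ component r y
  D-crosses-component {r} r↛r' = minimal-separating-crosses G minimal (component r) (component-invariant r)
    (λ same → r↛r' (reachable-sound G-D (trans (sym same) (reachable-complete G-D here))))

  S T : V → Bool
  S = component s₀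
  T = component t₀

  S∩T-empty : ∀ {z} → S z ≡ true → T z ≡ true → ⊥
  S∩T-empty z∈S z∈T = s₀↛t₀ (reachable-sound G-D z∈S ++ʷ reverseʷ G-D-sym (reachable-sound G-D z∈T))

  S-boundary⊆D : ∀ x y → adj G x y ≡ true → S x ≢ S y → D x y ≡ true
  S-boundary⊆D x y e Sx≢Sy with D x y in Dxy
  ... | true  = refl
  ... | false = ⊥-elim (Sx≢Sy (component-invariant s₀ x y (cong₂ (λ a d → a ∧ not d) e Dxy)))

  D-crosses-S : ∀ x y → D x y ≡ true → S x ≢ S y
  D-crosses-S = D-crosses-component s₀↛t₀

  D-crosses-T : ∀ x y → D x y ≡ true → T x ≢ T y
  D-crosses-T = D-crosses-component (λ w → s₀↛t₀ (reverseʷ G-D-sym w))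

  record Anchor (u : V) : Set where
    field
      a b  : V
      Dab  : D a b ≡ true
      a∈S  : S a ≡ true
      b∈T  : T b ≡ true
      walk : Walk D u a
  open Anchor

  anchor : ∀ {u} → Incident G D u → Anchor u
  anchor {u} (u' , Duu') with S u in u∈S
  ... | true  = record
    { a = u ; b = u' ; Dab = Duu' ; a∈S = u∈S ; walk = here
    ; b∈T = opposite false (¬-not (S∩T-empty u∈S)) (D-crosses-T u u' Duu') }
  ... | false = record
    { a = u' ; b = u ; Dab = Du'u ; a∈S = u'∈S ; walk = step Duu' here
    ; b∈T = opposite false (¬-not (S∩T-empty u'∈S)) (D-crosses-T u' u Du'u) }
    where
      Du'u : D u' u ≡ true
      Du'u = trans (Dsym u' u) Duu'
      u'∈S : S u' ≡ true
      u'∈S = opposite false u∈S (D-crosses-S u u' Duu')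

  b∉S : ∀ {u} (γ : Anchor u) → S (b γ) ≡ false
  b∉S γ = ¬-not (λ b∈S → S∩T-empty b∈S (b∈T γ))

  edge-subgraph-connected : Chordal G → EdgeSubgraphConnected G D
  edge-subgraph-connected chordal u v u∈ v∈ = walk α ++ʷ a₁→a₂ ++ʷ reverseʷ Dsym (walk β)
    where
      α = anchor u∈
      β = anchor v∈

      S-closed : ∀ s x y → G-D x y ≡ true → S x ≡ s → S y ≡ s
      S-closed s x y e Sx = trans (sym (component-invariant s₀ x y e)) Sx

      P : Path G-D (λ x → S x ≡ true) (a α) (a β)
      P = walk⇒path (S-closed true) (a∈S α)
            (reverseʷ G-D-sym (reachable-sound G-D (a∈S α)) ++ʷ reachable-sound G-D (a∈S β))

      Q : Path G-D (λ x → S x ≡ false) (b β) (b α)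
      Q = walk⇒path (S-closed false) (b∉S β)
            (reverseʷ G-D-sym (reachable-sound G-D (b∈T β)) ++ʷ reachable-sound G-D (b∈T α))

      inG : ∀ {I u v} (π : Path G-D I u v) → IsPath (adj G) I (len π) (vertex π)
      inG π = IsPath-map (λ _ _ → ∧-conicalˡ _ _) (λ _ x → x) (isPath π)

      bridge : adj G (vertex P (len P)) (vertex Q 0) ≡ true
      bridge = subst₂ (λ x y → adj G x y ≡ true) (sym (end P)) (sym (start Q)) (D⊆G _ _ (Dab β))

      closing : adj G (vertex Q (len Q)) (vertex P 0) ≡ true
      closing = subst₂ (λ x y → adj G x y ≡ true) (sym (end Q)) (sym (start P))
                  (D⊆G _ _ (trans (Dsym (b α) (a α)) (Dab α)))

      a₁→a₂ : Walk D (a α) (a β)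
      a₁→a₂ = subst₂ (Walk D) (start P) (end P)
        (sided-cycle-walk G chordal D Dsym S S-boundary⊆D (suc (len P + len Q)) ≤-refl (inG P) (inG Q) bridge closing)

lemma2 : (G : Graph) → Connected G → Chordal G →
    (D : EdgeSet (n G)) → MinimalSeparating G D → EdgeSubgraphConnected G D
lemma2 G _ chordal D minimal = edge-subgraph-connected G D minimal chordal
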